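{- Let $(G=(V,E),L,c,r,e_r)$ be a rooted WRAP instance with non-shortenable directed WRAP solution $\vec F\subseteq\mathrm{Shadows}(L)$, and let $U\subseteq V$ be nonempty with leftmost vertex $s$ and rightmost vertex $t$. Then $\mathrm{lca}(U)$ equals the least common ancestor of $s$ and $t$ in $(V,\vec F)$, and it lies between $s$ and $t$.
   Context: Rooted WRAP instance: cycle $G=(V,E)$, links $L\subseteq\binom V2$, costs $c$, root $r$, edge $e_r\in E$ at $r$. $\mathcal C_G=\{C\subseteq V\setminus\{r\}:|\delta_E(C)|=2\}$. Directed link $(u,v)$ covers $C$ if $v\in C,u\notin C$; directed WRAP solution covers all $C\in\mathcal C_G$. Shortening of $(u,v)$: $(s',v)$, $s'\ne v$, $s'$ on the $u$-$v$ path of $(V,E\setminus\{e_r\})$ (strict if $s'\ne u$); shadows of $\{u,v\}$: shortenings of $(u,v)$ or $(v,u)$. Non-shortenable: deleting or strictly shortening any link destroys feasibility; then $(V,\vec F)$ is an $r$-arborescence. $\mathrm{lca}(U)$ is the vertex farthest from $r$ in $(V,\vec F)$ that is an ancestor (vertices are their own ancestors) of all vertices of $U$. Number $V=\{r=v_0,\dots,v_{n-1}\}$ along the path $(V,E\setminus\{e_r\})$ from $r$; $v_i$ is left of $v_j$ if $i<j$. A vertex lies between $s$ and $t$ if it is on the $s$-$t$ path of $(V,E\setminus\{e_r\})$ (endpoints included). -}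

module Defs where

open import Data.Nat using (ℕ; zero; suc; _≤_; _<_; _<?_; s≤s)
open import Data.Fin using (Fin; toℕ; fromℕ<) renaming (zero to fzero)
open import Data.Fin.Subset using (Subset; _∈_; _∉_)
open import Data.Vec using (lookup)
open import Data.Bool using (Bool; true; false; if_then_else_; _xor_)
open import Data.List using (List; map; allFin)
open import Data.Nat.ListAction using (sum)
open import Data.Product using (Σ; ∃; _×_; _,_)
open import Data.Sum using (_⊎_)
open import Relation.Nullary using (¬_; yes; no)
open import Relation.Binary.PropositionalEquality using (_≡_; _≢_)

-- The vertex set is V = Fin n with n = suc m (n ≥ 3 is imposed
-- in the statement); vertex i is v_i of the context, the root is r = v_0 = fzero.
-- The cycle edges are {v_i , v_(i+1)} for i < n-1 (these form the path
-- (V, E \ {e_r}) from r) and e_r = {v_(n-1) , v_0}.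

next : ∀ {m} → Fin (suc m) → Fin (suc m)
next {m} i with suc (toℕ i) <? suc m
... | yes p = fromℕ< p
... | no _  = fzero

cutSize : ∀ {m} → Subset (suc m) → ℕ
cutSize {m} C =
  sum (map (λ i → if lookup C i xor lookup C (next i) then 1 else 0) (allFin (suc m)))

InCG : ∀ {m} → Subset (suc m) → Set
InCG C = (fzero ∉ C) × cutSize C ≡ 2

Between : ∀ {n} → Fin n → Fin n → Fin n → Set
Between a b x = (toℕ a ≤ toℕ x × toℕ x ≤ toℕ b) ⊎ (toℕ b ≤ toℕ x × toℕ x ≤ toℕ a)

-- sets of directed links / of (unordered) links, as predicates on pairs
DLinks : ℕ → Set₁
DLinks n = Fin n → Fin n → Set

IsShortening : ∀ {n} → Fin n → Fin n → Fin n → Fin n → Set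
IsShortening u v a b = (b ≡ v) × (a ≢ v) × Between u v a

Shadows : ∀ {n} → DLinks n → DLinks n
Shadows L a b = Σ _ λ u → Σ _ λ v → L u v × (IsShortening u v a b ⊎ IsShortening v u a b)

Covers : ∀ {n} → Fin n → Fin n → Subset n → Set
Covers u v C = (v ∈ C) × (u ∉ C)

Feasible : ∀ {m} → DLinks (suc m) → Set
Feasible F = ∀ C → InCG C → Σ _ λ u → Σ _ λ v → F u v × Covers u v C

Delete : ∀ {n} → DLinks n → Fin n → Fin n → DLinks n
Delete F u v a b = F a b × ¬ ((a ≡ u) × (b ≡ v))

Replace : ∀ {n} → DLinks n → Fin n → Fin n → Fin n → DLinks n
Replace F u v s a b = Delete F u v a b ⊎ ((a ≡ s) × (b ≡ v))

NonShortenable : ∀ {m} → DLinks (suc m) → Set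
NonShortenable F =
  Feasible F
  × (∀ u v → F u v → ¬ Feasible (Delete F u v))
  × (∀ u v s → F u v → IsShortening u v s v → s ≢ u → ¬ Feasible (Replace F u v s))

data Path {n} (F : DLinks n) : ℕ → Fin n → Fin n → Set where
  []  : ∀ {a} → Path F 0 a a
  _∷_ : ∀ {a b c k} → F a b → Path F k b c → Path F (suc k) a c

Ancestor : ∀ {n} → DLinks n → Fin n → Fin n → Set
Ancestor F a b = Σ ℕ λ k → Path F k a b

Dist : ∀ {n} → DLinks n → Fin n → Fin n → ℕ → Set
Dist F a b k = Path F k a b × (∀ j → Path F j a b → k ≤ j)

CommonAnc : ∀ {n} → DLinks n → (Fin n → Set) → Fin n → Set
CommonAnc F U w = ∀ u → U u → Ancestor F w u

IsLCA : ∀ {m} → DLinks (suc m) → (Fin (suc m) → Set) → Fin (suc m) → Set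
IsLCA F U w =
  CommonAnc F U w
  × (∀ a → CommonAnc F U a → ∀ da dw → Dist F fzero a da → Dist F fzero w dw → da ≤ dw)

{-# OPTIONS --safe #-}
module Submission where

-- The sets of 𝒞_G are exactly the intervals [i, j⟩ with 1 ≤ i < j ≤ n (a subset avoiding r
-- whose indicator changes exactly twice along the path), so F is feasible iff every such
-- interval is entered by a link.  Non-shortenability yields, for each link, an interval that
-- it alone enters, and for each strict shortening one that the shortening does not enter.
-- Comparing such intervals shows that every vertex other than r has exactly one parent and
-- that links nest without crossing.  Hence the arborescence is a search tree: the descendants
-- of each vertex h form an interval containing h, which h splits into the descendant
-- intervals of its children.  Descendant sets are therefore convex, so the common ancestor
-- of s and t lying between them is an ancestor of all of U, and comparing depths shows that
-- it is the deepest one.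

open import Defs
open import Data.Bool using (Bool; true; false; if_then_else_; _xor_)
open import Data.Bool.Properties using (¬-not) renaming (_≟_ to _≟ᵇ_)
open import Data.Empty using (⊥; ⊥-elim)
open import Data.Fin using (Fin; toℕ; fromℕ<) renaming (zero to fzero; suc to fsuc)
open import Data.Fin.Properties using (toℕ-fromℕ<; toℕ-injective; toℕ<n; any?) renaming (_≟_ to _≟ᶠ_)
open import Data.Fin.Subset using (Subset; _∈_; _∉_)
import Data.List as List
open import Data.List.Properties using (map-tabulate)
open import Data.Nat.ListAction using (sum)
open import Data.Vec using ([]; _∷_; lookup; tabulate)
open import Data.Vec.Properties using ([]=⇒lookup; lookup⇒[]=; lookup∘tabulate)
open import Data.Nat using (ℕ; zero; suc; _+_; _∸_; _⊓_; _⊔_; _≤_; _<_; _≤?_; _<?_; z≤n; s≤s; s≤s⁻¹)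
open import Data.Nat.Properties
open import Data.Product using (Σ; _×_; _,_; proj₁; proj₂)
open import Data.Sum using (_⊎_; inj₁; inj₂; [_,_]′)
open import Function using (id)
open import Function.Bundles using (_⇔_; mk⇔; Equivalence)
open Equivalence using (to; from)
open import Function.Properties.Equivalence using () renaming (trans to ⇔-trans; sym to ⇔-sym)
open import Relation.Binary.PropositionalEquality hiding ([_])
open import Relation.Nullary using (¬_; Dec; yes; no; does; contradiction)
open import Relation.Nullary.Decidable using (_×-dec_; ¬?; dec-true; dec-false; ¬¬-excluded-middle; decidable-stable)
open import Relation.Unary using (Decidable)
open import Relation.Binary.Definitions using (tri<; tri≈; tri>)

infix 4 _∈[_,_⟩
_∈[_,_⟩ : ℕ → ℕ → ℕ → Set
k ∈[ i , j ⟩ = i ≤ k × k < j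

_∈[_,_⟩? : ∀ k i j → Dec (k ∈[ i , j ⟩)
k ∈[ i , j ⟩? = (i ≤? k) ×-dec (k <? j)

∉[]⇒ : ∀ {k i j} → ¬ k ∈[ i , j ⟩ → k < i ⊎ j ≤ k
∉[]⇒ {k} {i} k∉ with i ≤? k
... | yes i≤k = inj₂ (≮⇒≥ λ k<j → k∉ (i≤k , k<j))
... | no  i≰k = inj₁ (≰⇒> i≰k)

StrictlyBetween : ℕ → ℕ → ℕ → Set
StrictlyBetween a b w = (a < w × w < b) ⊎ (b < w × w < a)

∈[]-convex : ∀ {i j x y z} → x ∈[ i , j ⟩ → z ∈[ i , j ⟩ → x ≤ y → y ≤ z → y ∈[ i , j ⟩
∈[]-convex (i≤x , _) (_ , z<j) x≤y y≤z = ≤-trans i≤x x≤y , ≤-<-trans y≤z z<j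

∈-union⁺ˡ : ∀ {k i₁ j₁} i₂ j₂ → k ∈[ i₁ , j₁ ⟩ → k ∈[ i₁ ⊓ i₂ , j₁ ⊔ j₂ ⟩
∈-union⁺ˡ {i₁ = i₁} {j₁} i₂ j₂ (i₁≤k , k<j₁) = ≤-trans (m⊓n≤m i₁ i₂) i₁≤k , <-≤-trans k<j₁ (m≤m⊔n j₁ j₂)

∈-union⁺ʳ : ∀ {k i₂ j₂} i₁ j₁ → k ∈[ i₂ , j₂ ⟩ → k ∈[ i₁ ⊓ i₂ , j₁ ⊔ j₂ ⟩
∈-union⁺ʳ {i₂ = i₂} {j₂} i₁ j₁ (i₂≤k , k<j₂) = ≤-trans (m⊓n≤n i₁ i₂) i₂≤k , <-≤-trans k<j₂ (m≤n⊔m j₁ j₂)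

∈-union⁻ : ∀ {k c i₁ j₁ i₂ j₂} → c ∈[ i₁ , j₁ ⟩ → c ∈[ i₂ , j₂ ⟩ →
           k ∈[ i₁ ⊓ i₂ , j₁ ⊔ j₂ ⟩ → k ∈[ i₁ , j₁ ⟩ ⊎ k ∈[ i₂ , j₂ ⟩
∈-union⁻ {k} {c} {i₁} {j₁} {i₂} {j₂} (i₁≤c , c<j₁) (i₂≤c , c<j₂) (lo≤k , k<hi) with ≤-total k c
... | inj₁ k≤c = [ (λ eq → inj₁ (subst (_≤ k) eq lo≤k , ≤-<-trans k≤c c<j₁))
                 , (λ eq → inj₂ (subst (_≤ k) eq lo≤k , ≤-<-trans k≤c c<j₂)) ]′ (⊓-sel i₁ i₂)
... | inj₂ c≤k = [ (λ eq → inj₁ (≤-trans i₁≤c c≤k , subst (k <_) eq k<hi))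
                 , (λ eq → inj₂ (≤-trans i₂≤c c≤k , subst (k <_) eq k<hi)) ]′ (⊔-sel j₁ j₂)

least : ∀ {P : ℕ → Set} → Decidable P → ∀ {b} → P b → Σ ℕ λ k → k ≤ b × P k × (∀ j → j < k → ¬ P j)
least {P} P? {b} Pb = [ (λ none → b , ≤-refl , Pb , none) , (λ (k , Pk , below) → k , ≮⇒≥ (λ b<k → below b b<k Pb) , Pk , below) ]′ (search b)
  where
  search : ∀ c → (∀ j → j < c → ¬ P j) ⊎ Σ ℕ λ k → P k × (∀ j → j < k → ¬ P j)
  search zero = inj₁ λ _ ()
  search (suc c) with search c
  ... | inj₂ found = inj₂ found
  ... | inj₁ none with P? c
  ...   | yes Pc = inj₂ (c , Pc , none)
  ...   | no ¬Pc = inj₁ λ j j<1+c → [ none j , (λ { refl → ¬Pc }) ]′ (m≤n⇒m<n∨m≡n (s≤s⁻¹ j<1+c))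

-- Boolean sequences with exactly two changes

changeAt : (ℕ → Bool) → ℕ → ℕ
changeAt f k = if f k xor f (suc k) then 1 else 0

changes : (ℕ → Bool) → ℕ → ℕ → ℕ
changes f a zero    = 0
changes f a (suc l) = changeAt f a + changes f (suc a) l

changesBelow : (ℕ → Bool) → ℕ → ℕ
changesBelow f = changes f 0

changeAt-≡ : ∀ f k → f k ≡ f (suc k) → changeAt f k ≡ 0
changeAt-≡ f k eq with f k | f (suc k)
... | true  | true  = refl
... | true  | false = contradiction eq λ ()
... | false | true  = contradiction eq λ ()
... | false | false = refl

changeAt-≢ : ∀ f k → f k ≢ f (suc k) → changeAt f k ≡ 1
changeAt-≢ f k neq with f k | f (suc k)
... | true  | true  = contradiction refl neq
... | true  | false = refl
... | false | true  = refl
... | false | false = contradiction refl neq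

changes-+ : ∀ f a k l → changes f a (k + l) ≡ changes f a k + changes f (a + k) l
changes-+ f a zero    l = cong (λ b → changes f b l) (sym (+-identityʳ a))
changes-+ f a (suc k) l = begin
  changeAt f a + changes f (suc a) (k + l)
    ≡⟨ cong (changeAt f a +_) (changes-+ f (suc a) k l) ⟩
  changeAt f a + (changes f (suc a) k + changes f (suc a + k) l)
    ≡⟨ sym (+-assoc (changeAt f a) _ _) ⟩
  changeAt f a + changes f (suc a) k + changes f (suc a + k) l
    ≡⟨ cong (λ b → changeAt f a + changes f (suc a) k + changes f b l) (sym (+-suc a k)) ⟩
  changeAt f a + changes f (suc a) k + changes f (a + suc k) l ∎
  where open ≡-Reasoning

changes-cong : ∀ {f g} → (∀ k → f k ≡ g k) → ∀ a l → changes f a l ≡ changes g a l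
changes-cong f≗g a zero    = refl
changes-cong f≗g a (suc l) =
  cong₂ _+_ (cong₂ (λ x y → if x xor y then 1 else 0) (f≗g a) (f≗g (suc a))) (changes-cong f≗g (suc a) l)

changes-≢ : ∀ f a k → f a ≢ f (a + k) → 1 ≤ changes f a k
changes-≢ f a zero    neq = contradiction (cong f (sym (+-identityʳ a))) neq
changes-≢ f a (suc k) neq with f a ≟ᵇ f (suc a)
... | no  step = ≤-trans (≤-reflexive (sym (changeAt-≢ f a step))) (m≤m+n _ _)
... | yes same = ≤-trans (changes-≢ f (suc a) k neq′) (m≤n+m _ _)
  where neq′ : f (suc a) ≢ f (suc a + k)
        neq′ eq = neq (trans same (trans eq (cong f (sym (+-suc a k)))))

changes-const : ∀ f a k → (∀ x → a ≤ x → x < a + k → f x ≡ f (suc x)) → changes f a k ≡ 0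
changes-const f a zero    _    = refl
changes-const f a (suc k) flat = cong₂ _+_
  (changeAt-≡ f a (flat a ≤-refl (m<m+n a (s≤s z≤n))))
  (changes-const f (suc a) k (λ x a<x x<1+a+k → flat x (<⇒≤ a<x) (subst (x <_) (sym (+-suc a k)) x<1+a+k)))

changesBelow-+ : ∀ f a k → changesBelow f (a + k) ≡ changesBelow f a + changes f a k
changesBelow-+ f = changes-+ f 0

changesBelow-split : ∀ f {a b} → a ≤ b → changesBelow f b ≡ changesBelow f a + changes f a (b ∸ a)
changesBelow-split f {a} {b} a≤b =
  trans (cong (changesBelow f) (sym (m+[n∸m]≡n a≤b))) (changesBelow-+ f a (b ∸ a))

changesBelow-< : ∀ f {a b} → a ≤ b → f a ≢ f b → changesBelow f a < changesBelow f b
changesBelow-< f {a} {b} a≤b neq = begin-strict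
  changesBelow f a                           <⟨ m<m+n _ (changes-≢ f a (b ∸ a) neq′) ⟩
  changesBelow f a + changes f a (b ∸ a)     ≡⟨ sym (changesBelow-split f a≤b) ⟩
  changesBelow f b                           ∎
  where
  open ≤-Reasoning
  neq′ : f a ≢ f (a + (b ∸ a))
  neq′ eq = neq (trans eq (cong f (m+[n∸m]≡n a≤b)))

changesBelow-const : ∀ f {a b} → a ≤ b → (∀ x → a ≤ x → x < b → f x ≡ f (suc x)) →
                     changesBelow f b ≡ changesBelow f a
changesBelow-const f {a} {b} a≤b flat = begin
  changesBelow f b                        ≡⟨ changesBelow-split f a≤b ⟩
  changesBelow f a + changes f a (b ∸ a)  ≡⟨ cong (changesBelow f a +_) (changes-const f a (b ∸ a) flat′) ⟩
  changesBelow f a + 0                    ≡⟨ +-identityʳ _ ⟩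
  changesBelow f a                        ∎
  where
  open ≡-Reasoning
  flat′ : ∀ x → a ≤ x → x < a + (b ∸ a) → f x ≡ f (suc x)
  flat′ x a≤x x<b = flat x a≤x (subst (x <_) (m+[n∸m]≡n a≤b) x<b)

changesBelow-step : ∀ f a → f a ≢ f (suc a) → changesBelow f (suc a) ≡ suc (changesBelow f a)
changesBelow-step f a neq = begin
  changesBelow f (suc a)                ≡⟨ cong (changesBelow f) (+-comm 1 a) ⟩
  changesBelow f (a + 1)                ≡⟨ changesBelow-+ f a 1 ⟩
  changesBelow f a + (changeAt f a + 0) ≡⟨ cong (λ c → changesBelow f a + c) (trans (+-identityʳ _) (changeAt-≢ f a neq)) ⟩
  changesBelow f a + 1                  ≡⟨ +-comm _ 1 ⟩
  suc (changesBelow f a)                ∎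
  where open ≡-Reasoning

no-true-false-true : ∀ f {n x y z} → f 0 ≡ false → f n ≡ false → changesBelow f n ≡ 2 →
                     x < y → y < z → z < n → f x ≡ true → f y ≡ false → f z ≡ true → ⊥
no-true-false-true f {n} {x} {y} {z} f0 fn two x<y y<z z<n fx fy fz = 4≰2 (subst (4 ≤_) two 4≤)
  where
  open ≤-Reasoning
  t≢f : ∀ {a b} → f a ≡ true → f b ≡ false → f a ≢ f b
  t≢f fa fb eq with () ← trans (sym fa) (trans eq fb)
  4≰2 : ¬ 4 ≤ 2
  4≰2 (s≤s (s≤s ()))
  4≤ : 4 ≤ changesBelow f n
  4≤ = begin
    4                                ≤⟨ s≤s (s≤s (s≤s (changesBelow-< f z≤n (λ eq → t≢f fx f0 (sym eq))))) ⟩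
    suc (suc (suc (changesBelow f x))) ≤⟨ s≤s (s≤s (changesBelow-< f (<⇒≤ x<y) (t≢f fx fy))) ⟩
    suc (suc (changesBelow f y))       ≤⟨ s≤s (changesBelow-< f (<⇒≤ y<z) (λ eq → t≢f fz fy (sym eq))) ⟩
    suc (changesBelow f z)             ≤⟨ changesBelow-< f (<⇒≤ z<n) (t≢f fz fn) ⟩
    changesBelow f n                   ∎

twoChanges⇒interval : ∀ f n → f 0 ≡ false → (∀ k → n ≤ k → f k ≡ false) → changesBelow f n ≡ 2 →
  Σ ℕ λ i → Σ ℕ λ j → 1 ≤ i × i < j × j ≤ n × (∀ k → f k ≡ true ⇔ k ∈[ i , j ⟩)
twoChanges⇒interval f n f0 beyond two with anyUpTo? (λ k → f k ≟ᵇ true) n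
... | no none = contradiction (trans (sym two) no-changes) λ ()
  where
  false-at : ∀ k → f k ≡ false
  false-at k with k <? n
  ... | yes k<n = ¬-not λ fk → none (k , k<n , fk)
  ... | no  k≮n = beyond k (≮⇒≥ k≮n)
  no-changes : changesBelow f n ≡ 0
  no-changes = changesBelow-const f {b = n} z≤n (λ x _ _ → trans (false-at x) (sym (false-at (suc x))))
... | yes (x , x<n , fx) with least (λ k → f k ≟ᵇ true) fx
...   | i , i≤x , fi , below-i with least (λ k → (i ≤? k) ×-dec (f k ≟ᵇ false)) {n} (≤-trans i≤x (<⇒≤ x<n) , beyond n ≤-refl)
...     | j , j≤n , (i≤j , fj) , below-j = i , j , 1≤i , i<j , j≤n , λ k → mk⇔ (inside k) (outside k)
  where
  true≢false : ∀ {a b} → f a ≡ true → f b ≡ false → a ≢ b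
  true≢false fa fb refl with () ← trans (sym fa) fb
  1≤i : 1 ≤ i
  1≤i = ≤∧≢⇒< z≤n (λ 0≡i → true≢false fi f0 (sym 0≡i))
  i<j : i < j
  i<j = ≤∧≢⇒< i≤j (true≢false fi fj)
  inside : ∀ k → f k ≡ true → k ∈[ i , j ⟩
  inside k fk = ≮⇒≥ (λ k<i → below-i k k<i fk) , ≰⇒> j≰k
    where
    j≰k : ¬ j ≤ k
    j≰k j≤k = no-true-false-true f f0 (beyond n ≤-refl) two i<j j<k k<n fi fj fk
      where
      j<k = ≤∧≢⇒< j≤k (λ j≡k → true≢false fk fj (sym j≡k))
      k<n = ≰⇒> λ n≤k → true≢false fk (beyond k n≤k) refl
  outside : ∀ k → k ∈[ i , j ⟩ → f k ≡ true
  outside k (i≤k , k<j) = ¬-not λ fk → below-j k k<j (i≤k , fk)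

-- The cuts of the cycle are the intervals [i, j⟩

mem : ∀ {n} → Subset n → ℕ → Bool
mem []      _       = false
mem (b ∷ C) zero    = b
mem (b ∷ C) (suc k) = mem C k

lookup≡mem : ∀ {n} (C : Subset n) x → lookup C x ≡ mem C (toℕ x)
lookup≡mem (b ∷ C) fzero    = refl
lookup≡mem (b ∷ C) (fsuc x) = lookup≡mem C x

mem-beyond : ∀ {n} (C : Subset n) {k} → n ≤ k → mem C k ≡ false
mem-beyond []      _         = refl
mem-beyond (b ∷ C) (s≤s n≤k) = mem-beyond C n≤k

mem-tabulate : ∀ {n} (g : ℕ → Bool) {k} → k < n → mem (tabulate {n = n} λ x → g (toℕ x)) k ≡ g k
mem-tabulate {suc n} g {zero}  _         = refl
mem-tabulate {suc n} g {suc k} (s≤s k<n) = mem-tabulate (λ k → g (suc k)) k<n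

∈⇔mem : ∀ {n} {C : Subset n} {x} → x ∈ C ⇔ mem C (toℕ x) ≡ true
∈⇔mem {C = C} {x} = mk⇔ (λ x∈C → trans (sym (lookup≡mem C x)) ([]=⇒lookup x∈C))
                        (λ eq → lookup⇒[]= x C (trans (lookup≡mem C x) eq))

-- The cycle edge {v_(n-1), v_0} is seen as the change at position n, past the end of C.
lookup-next≡mem : ∀ {m} (C : Subset (suc m)) → mem C 0 ≡ false → ∀ i → lookup C (next i) ≡ mem C (suc (toℕ i))
lookup-next≡mem {m} C C0 i with suc (toℕ i) <? suc m
... | yes p = trans (lookup≡mem C (fromℕ< p)) (cong (mem C) (toℕ-fromℕ< p))
... | no ¬p = trans (lookup≡mem C fzero) (trans C0 (sym (mem-beyond C (≮⇒≥ ¬p))))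

sum-changeAt : ∀ f n a (h : Fin n → ℕ) → (∀ i → h i ≡ changeAt f (a + toℕ i)) → sum (List.tabulate h) ≡ changes f a n
sum-changeAt f zero    a h h≗ = refl
sum-changeAt f (suc n) a h h≗ = cong₂ _+_
  (trans (h≗ fzero) (cong (changeAt f) (+-identityʳ a)))
  (sum-changeAt f n (suc a) (λ i → h (fsuc i)) (λ i → trans (h≗ (fsuc i)) (cong (changeAt f) (+-suc a (toℕ i)))))

cutSize≡changesBelow : ∀ {m} (C : Subset (suc m)) → mem C 0 ≡ false → cutSize C ≡ changesBelow (mem C) (suc m)
cutSize≡changesBelow {m} C C0 = trans (cong sum (map-tabulate id h))
  (sum-changeAt (mem C) (suc m) 0 h λ i → cong₂ (λ x y → if x xor y then 1 else 0) (lookup≡mem C i) (lookup-next≡mem C C0 i))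
  where
  h : Fin (suc m) → ℕ
  h i = if lookup C i xor lookup C (next i) then 1 else 0

ProperInterval : ℕ → ℕ → ℕ → Set
ProperInterval n i j = 1 ≤ i × i < j × j ≤ n

InCG⇒interval : ∀ {m} (C : Subset (suc m)) → InCG C →
  Σ ℕ λ i → Σ ℕ λ j → ProperInterval (suc m) i j × (∀ x → x ∈ C ⇔ toℕ x ∈[ i , j ⟩)
InCG⇒interval {m} C (0∉C , cut≡2)
  with twoChanges⇒interval (mem C) (suc m) C0 (λ k → mem-beyond C) (trans (sym (cutSize≡changesBelow C C0)) cut≡2)
  where C0 = ¬-not λ C0≡true → 0∉C (from ∈⇔mem C0≡true)
... | i , j , 1≤i , i<j , j≤n , mem⇔ = i , j , (1≤i , i<j , j≤n) , λ x → ⇔-trans ∈⇔mem (mem⇔ (toℕ x))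

does⇔ : ∀ {P : Set} (P? : Dec P) → does P? ≡ true ⇔ P
does⇔ (yes p) = mk⇔ (λ _ → p) (λ _ → refl)
does⇔ (no ¬p) = mk⇔ (λ ()) (λ p → contradiction p ¬p)

intervalSubset : ∀ {n} → ℕ → ℕ → Subset n
intervalSubset i j = tabulate λ x → does (toℕ x ∈[ i , j ⟩?)

∈-intervalSubset : ∀ {n} {i j} (x : Fin n) → x ∈ intervalSubset i j ⇔ toℕ x ∈[ i , j ⟩
∈-intervalSubset {i = i} {j} x = mk⇔
  (λ x∈ → to (does⇔ (toℕ x ∈[ i , j ⟩?)) (trans (sym (lookup∘tabulate _ x)) ([]=⇒lookup x∈)))
  (λ x∈[i,j⟩ → lookup⇒[]= x _ (trans (lookup∘tabulate _ x) (dec-true (toℕ x ∈[ i , j ⟩?) x∈[i,j⟩)))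

changesBelow-interval : ∀ {n i j} → ProperInterval n i j → changesBelow (λ k → does (k ∈[ i , j ⟩?)) n ≡ 2
changesBelow-interval {n} {suc a} {suc c} (s≤s z≤n , s≤s a<c , c<n) = begin
  changesBelow g n              ≡⟨ changesBelow-const g c<n (λ x c<x _ → trans (beyond x c<x) (sym (beyond (suc x) (m≤n⇒m≤1+n c<x)))) ⟩
  changesBelow g (suc c)        ≡⟨ changesBelow-step g c (true≢false c (suc c) (inside c (a<c , ≤-refl)) (beyond (suc c) ≤-refl)) ⟩
  suc (changesBelow g c)        ≡⟨ cong suc (changesBelow-const g a<c (λ x a<x x<c → trans (inside x (a<x , m≤n⇒m≤1+n x<c)) (sym (inside (suc x) (m≤n⇒m≤1+n a<x , s≤s x<c))))) ⟩
  suc (changesBelow g (suc a))  ≡⟨ cong suc (changesBelow-step g a (λ eq → true≢false (suc a) a (inside (suc a) (≤-refl , s≤s a<c)) (below a ≤-refl) (sym eq))) ⟩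
  2 + changesBelow g a          ≡⟨ cong (2 +_) (changesBelow-const g z≤n (λ x _ x<a → trans (below x (<⇒≤ x<a)) (sym (below (suc x) x<a)))) ⟩
  2                             ∎
  where
  open ≡-Reasoning
  g : ℕ → Bool
  g k = does (k ∈[ suc a , suc c ⟩?)
  below : ∀ x → x ≤ a → g x ≡ false
  below x x≤a = dec-false (x ∈[ suc a , suc c ⟩?) λ (a<x , _) → <⇒≱ a<x x≤a
  inside : ∀ x → x ∈[ suc a , suc c ⟩ → g x ≡ true
  inside x = dec-true (x ∈[ suc a , suc c ⟩?)
  beyond : ∀ x → c < x → g x ≡ false
  beyond x c<x = dec-false (x ∈[ suc a , suc c ⟩?) λ (_ , x≤c) → <⇒≱ c<x (s≤s⁻¹ x≤c)
  true≢false : ∀ x y → g x ≡ true → g y ≡ false → g x ≢ g y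
  true≢false _ _ gx gy eq with () ← trans (sym gx) (trans eq gy)

mem-intervalSubset : ∀ {n i j} → j ≤ n → ∀ k → mem (intervalSubset {n} i j) k ≡ does (k ∈[ i , j ⟩?)
mem-intervalSubset {n} {i} {j} j≤n k with k <? n
... | yes k<n = mem-tabulate (λ k → does (k ∈[ i , j ⟩?)) k<n
... | no  k≮n = trans (mem-beyond (intervalSubset i j) n≤k) (sym (dec-false (k ∈[ i , j ⟩?) λ (_ , k<j) → <⇒≱ k<j (≤-trans j≤n n≤k)))
  where n≤k = ≮⇒≥ k≮n

interval⇒InCG : ∀ {m i j} → ProperInterval (suc m) i j → InCG (intervalSubset {suc m} i j)
interval⇒InCG {m} {i} {j} I@(1≤i , _ , j≤n) = 0∉ , (begin
  cutSize (intervalSubset {suc m} i j)                   ≡⟨ cutSize≡changesBelow {m} (intervalSubset i j) (trans (mem-intervalSubset {i = i} j≤n 0) (dec-false (0 ∈[ i , j ⟩?) 0∉I)) ⟩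
  changesBelow (mem (intervalSubset {suc m} i j)) (suc m) ≡⟨ changes-cong (mem-intervalSubset {i = i} j≤n) 0 (suc m) ⟩
  changesBelow (λ k → does (k ∈[ i , j ⟩?)) (suc m)       ≡⟨ changesBelow-interval I ⟩
  2                                                      ∎)
  where
  open ≡-Reasoning
  0∉I : ¬ 0 ∈[ i , j ⟩
  0∉I (i≤0 , _) = <⇒≱ 1≤i i≤0
  0∉ : fzero ∉ intervalSubset i j
  0∉ 0∈ = 0∉I (to (∈-intervalSubset {i = i} {j} fzero) 0∈)

Enters : ∀ {n} → ℕ → ℕ → Fin n → Fin n → Set
Enters i j u v = toℕ v ∈[ i , j ⟩ × ¬ toℕ u ∈[ i , j ⟩

IntervalFeasible : ∀ {m} → DLinks (suc m) → Set
IntervalFeasible {m} G = ∀ i j → ProperInterval (suc m) i j → Σ _ λ u → Σ _ λ v → G u v × Enters i j u v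

covers⇔enters : ∀ {n} {C : Subset n} {i j} → (∀ x → x ∈ C ⇔ toℕ x ∈[ i , j ⟩) → ∀ {u v} → Covers u v C ⇔ Enters i j u v
covers⇔enters C≡I {u} {v} = mk⇔ (λ (v∈ , u∉) → to (C≡I v) v∈ , λ u∈ → u∉ (from (C≡I u) u∈))
                                (λ (v∈ , u∉) → from (C≡I v) v∈ , λ u∈ → u∉ (to (C≡I u) u∈))

feasible⇔intervalFeasible : ∀ {m} {G : DLinks (suc m)} → Feasible G ⇔ IntervalFeasible G
feasible⇔intervalFeasible {m} {G} = mk⇔ intervals feasible
  where
  intervals : Feasible G → IntervalFeasible G
  intervals feas i j I with feas (intervalSubset i j) (interval⇒InCG I)
  ... | u , v , Guv , covers = u , v , Guv , to (covers⇔enters ∈-intervalSubset) covers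
  feasible : IntervalFeasible G → Feasible G
  feasible feas C C∈CG with InCG⇒interval C C∈CG
  ... | i , j , I , C≡I with feas i j I
  ...   | u , v , Guv , enters = u , v , Guv , from (covers⇔enters C≡I) enters

¬¬-∀-Fin : ∀ n {P : Fin n → Set} → (∀ i → ¬ ¬ P i) → ¬ ¬ (∀ i → P i)
¬¬-∀-Fin zero    _     ¬∀ = ¬∀ λ ()
¬¬-∀-Fin (suc n) ¬¬P ¬∀ = ¬¬P fzero λ P0 → ¬¬-∀-Fin n (λ i → ¬¬P (fsuc i)) λ P+ →
  ¬∀ λ { fzero → P0 ; (fsuc i) → P+ i }

_++ₚ_ : ∀ {n} {F : DLinks n} {j k a b c} → Path F j a b → Path F k b c → Path F (j + k) a c
[]          ++ₚ path′ = path′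
(Fab ∷ path) ++ₚ path′ = Fab ∷ (path ++ₚ path′)

module NonShortenableSolution {m} {F : DLinks (suc m)} (NS : NonShortenable F) where

  V : Set
  V = Fin (suc m)

  UniquelyEnters : ℕ → ℕ → V → V → Set
  UniquelyEnters i j u v = ∀ a b → F a b → Enters i j a b → a ≡ u × b ≡ v

  Critical : ℕ → ℕ → V → V → Set
  Critical i j u v = ProperInterval (suc m) i j × UniquelyEnters i j u v

  opaque
    intervalFeasible : IntervalFeasible F
    intervalFeasible = to feasible⇔intervalFeasible (proj₁ NS)

  critical⇒enters : ∀ {i j u v} → Critical i j u v → Enters i j u v
  critical⇒enters {i} {j} (I , unique) with intervalFeasible i j I
  ... | a , b , Fab , enters with unique a b Fab enters
  ...   | refl , refl = enters

  tail-inside : ∀ {i j u v a b} → UniquelyEnters i j u v → F a b → toℕ b ∈[ i , j ⟩ → ¬ (a ≡ u × b ≡ v) → toℕ a ∈[ i , j ⟩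
  tail-inside {i} {j} {a = a} unique Fab b∈ other with toℕ a ∈[ i , j ⟩?
  ... | yes a∈ = a∈
  ... | no  a∉ = contradiction (unique _ _ Fab (b∈ , a∉)) other

  -- Every consequence of non-shortenability drawn below is a negative statement,
  -- so F may be treated as decidable.
  links-decidable : ¬ ¬ (∀ a b → Dec (F a b))
  links-decidable = ¬¬-∀-Fin _ λ a → ¬¬-∀-Fin _ λ b → ¬¬-excluded-middle

  other-or-unique : (∀ a b → Dec (F a b)) → ∀ u v i j →
    (Σ V λ a → Σ V λ b → Delete F u v a b × Enters i j a b) ⊎ UniquelyEnters i j u v
  other-or-unique F? u v i j with any? (λ a → any? (λ b → (F? a b ×-dec ¬? ((a ≟ᶠ u) ×-dec (b ≟ᶠ v))) ×-dec enters? a b))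
    where enters? : ∀ a b → Dec (Enters i j a b)
          enters? a b = (toℕ b ∈[ i , j ⟩?) ×-dec ¬? (toℕ a ∈[ i , j ⟩?)
  ... | yes (a , b , other) = inj₁ (a , b , other)
  ... | no  none = inj₂ λ a b Fab enters → decidable-stable ((a ≟ᶠ u) ×-dec (b ≟ᶠ v)) λ ¬uv → none (a , b , (Fab , ¬uv) , enters)

  deletion-critical : ∀ {u v} → F u v → ¬ ¬ (Σ ℕ λ i → Σ ℕ λ j → Critical i j u v)
  deletion-critical {u} {v} Fuv none = links-decidable λ F? → proj₁ (proj₂ NS) u v Fuv
    (from feasible⇔intervalFeasible λ i j I →
      [ id , (λ unique → contradiction (i , j , I , unique) none) ]′ (other-or-unique F? u v i j))

  shortening-critical : ∀ {u v s} → F u v → IsShortening u v s v → s ≢ u →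
    ¬ ¬ (Σ ℕ λ i → Σ ℕ λ j → Critical i j u v × ¬ Enters i j s v)
  shortening-critical {u} {v} {s} Fuv shortening s≢u none = links-decidable λ F? → proj₂ (proj₂ NS) u v s Fuv shortening s≢u
    (from feasible⇔intervalFeasible λ i j I → replace i j I (other-or-unique F? u v i j))
    where
    replace : ∀ i j → ProperInterval (suc m) i j →
              (Σ V λ a → Σ V λ b → Delete F u v a b × Enters i j a b) ⊎ UniquelyEnters i j u v →
              Σ V λ a → Σ V λ b → Replace F u v s a b × Enters i j a b
    replace i j I (inj₁ (a , b , kept , enters)) = a , b , inj₁ kept , enters
    replace i j I (inj₂ unique) with (toℕ v ∈[ i , j ⟩?) ×-dec ¬? (toℕ s ∈[ i , j ⟩?)
    ... | yes enters = s , v , inj₂ (refl , refl) , enters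
    ... | no  ¬enters = contradiction (i , j , (I , unique) , ¬enters) none

  -- A link entering the union of the two intervals enters one of them, so it is (u₁, v₁)
  -- or (u₂, v₂); but both tails lie in the union.
  critical-no-crossing : ∀ {i₁ j₁ u₁ v₁ i₂ j₂ u₂ v₂ c} → Critical i₁ j₁ u₁ v₁ → Critical i₂ j₂ u₂ v₂ →
    c ∈[ i₁ , j₁ ⟩ → c ∈[ i₂ , j₂ ⟩ → toℕ u₁ ∈[ i₂ , j₂ ⟩ → toℕ u₂ ∈[ i₁ , j₁ ⟩ → ⊥
  critical-no-crossing {i₁} {j₁} {i₂ = i₂} {j₂} ((1≤i₁ , i₁<j₁ , j₁≤n) , unique₁) ((1≤i₂ , _ , j₂≤n) , unique₂)
                       c∈₁ c∈₂ u₁∈₂ u₂∈₁ with intervalFeasible (i₁ ⊓ i₂) (j₁ ⊔ j₂) union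
    where
    union : ProperInterval (suc m) (i₁ ⊓ i₂) (j₁ ⊔ j₂)
    union = ⊓-glb 1≤i₁ 1≤i₂ , ≤-<-trans (m⊓n≤m i₁ i₂) (<-≤-trans i₁<j₁ (m≤m⊔n j₁ j₂)) , ⊔-lub j₁≤n j₂≤n
  ... | a , b , Fab , b∈ , a∉ =
    [ exits unique₁ (∈-union⁺ˡ i₂ j₂) (∈-union⁺ʳ i₁ j₁ u₁∈₂)
    , exits unique₂ (∈-union⁺ʳ i₁ j₁) (∈-union⁺ˡ i₂ j₂ u₂∈₁) ]′ (∈-union⁻ c∈₁ c∈₂ b∈)
    where
    exits : ∀ {i j u v} → UniquelyEnters i j u v → (∀ {k} → k ∈[ i , j ⟩ → k ∈[ i₁ ⊓ i₂ , j₁ ⊔ j₂ ⟩) →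
            toℕ u ∈[ i₁ ⊓ i₂ , j₁ ⊔ j₂ ⟩ → toℕ b ∈[ i , j ⟩ → ⊥
    exits unique ⊆∪ u∈∪ b∈I with unique a b Fab (b∈I , λ a∈I → a∉ (⊆∪ a∈I))
    ... | refl , _ = a∉ u∈∪

  no-link-into-root : ∀ {a} → ¬ F a fzero
  no-link-into-root Fa0 = deletion-critical Fa0 λ (i , j , C) →
    <⇒≱ (proj₁ (proj₁ C)) (proj₁ (proj₁ (critical⇒enters C)))

  link-tails-equal : ∀ {a a′ b} → F a b → F a′ b → a ≡ a′
  link-tails-equal {a} {a′} Fab Fa′b with a ≟ᶠ a′
  ... | yes a≡a′ = a≡a′
  ... | no  a≢a′ = ⊥-elim (deletion-critical Fab λ (_ , _ , C₁) → deletion-critical Fa′b λ (_ , _ , C₂) →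
    let b∈₁ = proj₁ (critical⇒enters C₁)
        b∈₂ = proj₁ (critical⇒enters C₂)
    in critical-no-crossing C₁ C₂ b∈₁ b∈₂
         (tail-inside (proj₂ C₂) Fab b∈₂ λ (a≡a′ , _) → a≢a′ a≡a′)
         (tail-inside (proj₂ C₁) Fa′b b∈₁ λ (a′≡a , _) → a≢a′ (sym a′≡a)))

  opaque
    parent-exists : ∀ v → 1 ≤ toℕ v → Σ V λ u → F u v
    parent-exists v 1≤v with intervalFeasible (toℕ v) (suc (toℕ v)) (1≤v , ≤-refl , toℕ<n v)
    ... | u , v′ , Fuv′ , (v≤v′ , v′<1+v) , _ with toℕ-injective {i = v′} {j = v} (≤-antisym (s≤s⁻¹ v′<1+v) v≤v′)
    ...   | refl = u , Fuv′

  p : V → V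
  p fzero      = fzero
  p v@(fsuc _) = proj₁ (parent-exists v (s≤s z≤n))

  P : V → ℕ
  P x = toℕ (p x)

  parent-link : ∀ {v} → v ≢ fzero → F (p v) v
  parent-link {fzero}  v≢0 = contradiction refl v≢0
  parent-link {fsuc k} _   = proj₂ (parent-exists (fsuc k) (s≤s z≤n))

  link⇒parent : ∀ {a b} → F a b → a ≡ p b
  link⇒parent {b = fzero}  Fa0 = ⊥-elim (no-link-into-root Fa0)
  link⇒parent {b = fsuc _} Fab = link-tails-equal Fab (parent-link λ ())

  -- Critical for the shortening of (p x, x) to (w, x).
  shortcut-critical : ∀ {x w} → StrictlyBetween (P x) (toℕ x) (toℕ w) →
    ¬ ¬ (Σ ℕ λ i → Σ ℕ λ j → Critical i j (p x) x × toℕ w ∈[ i , j ⟩ × P w ∈[ i , j ⟩)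
  shortcut-critical {x} {w} btw none =
    shortening-critical (parent-link x≢0) (refl , w≢x , between btw) w≢px λ (i , j , C , ¬enters) →
      let w∈ = ¬enters⇒inside (proj₁ (critical⇒enters C)) ¬enters
      in  none (i , j , C , w∈ , tail-inside (proj₂ C) (parent-link w≢0) w∈ λ (_ , w≡x) → w≢x w≡x)
    where
    ≢-from-< : ∀ {a b : V} → toℕ a < toℕ b → a ≢ b
    ≢-from-< a<b refl = <-irrefl refl a<b
    ¬enters⇒inside : ∀ {i j} → toℕ x ∈[ i , j ⟩ → ¬ Enters i j w x → toℕ w ∈[ i , j ⟩
    ¬enters⇒inside {i} {j} x∈ ¬enters with toℕ w ∈[ i , j ⟩?
    ... | yes w∈ = w∈
    ... | no  w∉ = contradiction (x∈ , w∉) ¬enters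
    between : StrictlyBetween (P x) (toℕ x) (toℕ w) → Between (p x) x w
    between (inj₁ (Px<w , w<x)) = inj₁ (<⇒≤ Px<w , <⇒≤ w<x)
    between (inj₂ (x<w , w<Px)) = inj₂ (<⇒≤ x<w , <⇒≤ w<Px)
    w≢x : w ≢ x
    w≢x = [ (λ (_ , w<x) → ≢-from-< w<x) , (λ (x<w , _) w≡x → ≢-from-< x<w (sym w≡x)) ]′ btw
    w≢px : w ≢ p x
    w≢px = [ (λ (Px<w , _) w≡px → ≢-from-< Px<w (sym w≡px)) , (λ (_ , w<Px) → ≢-from-< w<Px) ]′ btw
    w≢0 : w ≢ fzero
    w≢0 refl = [ (λ (Px<0 , _) → n≮0 Px<0) , (λ (x<0 , _) → n≮0 x<0) ]′ btw
    x≢0 : x ≢ fzero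
    x≢0 refl = [ (λ (0<w , w<0) → n≮0 w<0) , (λ (_ , w<0) → n≮0 w<0) ]′ btw

  right-span-parent : ∀ {x w} → P x < toℕ w → toℕ w < toℕ x → P x < P w
  right-span-parent Px<w w<x = ≰⇒> λ Pw≤Px → shortcut-critical (inj₁ (Px<w , w<x)) λ (_ , _ , C , w∈ , pw∈) →
    proj₂ (critical⇒enters C) (∈[]-convex pw∈ w∈ Pw≤Px (<⇒≤ Px<w))

  left-span-parent : ∀ {x w} → toℕ x < toℕ w → toℕ w < P x → P w < P x
  left-span-parent x<w w<Px = ≰⇒> λ Px≤Pw → shortcut-critical (inj₂ (x<w , w<Px)) λ (_ , _ , C , w∈ , pw∈) →
    proj₂ (critical⇒enters C) (∈[]-convex w∈ pw∈ (<⇒≤ w<Px) Px≤Pw)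

  links-don't-cross : ∀ {x h} → P x < toℕ h → toℕ h < toℕ x → toℕ x < P h → ⊥
  links-don't-cross Px<h h<x x<Ph =
    shortcut-critical (inj₁ (Px<h , h<x)) λ (_ , _ , C₁ , h∈₁ , ph∈₁) →
    shortcut-critical (inj₂ (h<x , x<Ph)) λ (_ , _ , C₂ , _ , px∈₂) →
    critical-no-crossing C₁ C₂ h∈₁ (proj₁ (critical⇒enters C₂)) px∈₂ ph∈₁

  nested-right : ∀ {x w} → P x < toℕ w → toℕ w < toℕ x → P x < P w × P w ≤ toℕ x
  nested-right Px<w w<x = right-span-parent Px<w w<x , ≮⇒≥ (links-don't-cross Px<w w<x)

  nested-left : ∀ {x w} → toℕ x < toℕ w → toℕ w < P x → toℕ x ≤ P w × P w < P x
  nested-left x<w w<Px = ≮⇒≥ (λ Pw<x → links-don't-cross Pw<x x<w w<Px) , left-span-parent x<w w<Px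

  interval-entry : ∀ {i j} → ProperInterval (suc m) i j → Σ V λ x → toℕ x ∈[ i , j ⟩ × ¬ P x ∈[ i , j ⟩
  interval-entry {i} {j} I with intervalFeasible i j I
  ... | u , v , Fuv , v∈ , u∉ with link⇒parent Fuv
  ...   | refl = v , v∈ , u∉

  siblings-ordered : ∀ {a b x y} → ¬ P x ∈[ a , b ⟩ → toℕ x ∈[ a , b ⟩ → toℕ y ∈[ a , b ⟩ → P x ≡ P y → toℕ x < toℕ y → ⊥
  siblings-ordered Px∉ (a≤x , _) (_ , y<b) Px≡Py x<y with ∉[]⇒ Px∉
  ... | inj₁ Px<a = <-irrefl (sym Px≡Py) (proj₁ (nested-right (subst (_< _) Px≡Py (<-≤-trans Px<a a≤x)) x<y))
  ... | inj₂ b≤Px = <-irrefl (sym Px≡Py) (proj₂ (nested-left x<y (<-≤-trans y<b b≤Px)))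

  siblings-in-interval : ∀ {a b x y} → ¬ P x ∈[ a , b ⟩ → toℕ x ∈[ a , b ⟩ → toℕ y ∈[ a , b ⟩ → p x ≡ p y → x ≡ y
  siblings-in-interval {a} {b} {x} {y} Px∉ x∈ y∈ px≡py with <-cmp (toℕ x) (toℕ y)
  ... | tri≈ _ x≡y _ = toℕ-injective x≡y
  ... | tri< x<y _ _ = ⊥-elim (siblings-ordered Px∉ x∈ y∈ (cong toℕ px≡py) x<y)
  ... | tri> _ _ y<x = ⊥-elim (siblings-ordered (subst (λ k → ¬ k ∈[ a , b ⟩) (cong toℕ px≡py) Px∉) y∈ x∈ (cong toℕ (sym px≡py)) y<x)

  -- Block a b h: the interval [a, b⟩ is exactly the set of descendants of h.
  record Block (a b : ℕ) (h : V) : Set where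
    field
      proper    : ProperInterval (suc m) a b
      head∈     : toℕ h ∈[ a , b ⟩
      head-exit : ¬ P h ∈[ a , b ⟩
      parent∈   : ∀ x → toℕ x ∈[ a , b ⟩ → x ≢ h → P x ∈[ a , b ⟩
      closed    : ∀ y → y ≢ fzero → ¬ toℕ y ∈[ a , b ⟩ → ¬ P y ∈[ a , b ⟩

  block-below : ∀ {a b} q → ProperInterval (suc m) a b →
    (∀ x → toℕ x ∈[ a , b ⟩ → ¬ P x ∈[ a , b ⟩ → p x ≡ q) →
    (∀ y → y ≢ fzero → ¬ toℕ y ∈[ a , b ⟩ → ¬ P y ∈[ a , b ⟩) →
    Σ V λ h → p h ≡ q × Block a b h
  block-below {a} {b} q I entries closed with interval-entry I
  ... | h , h∈ , Ph∉ = h , entries h h∈ Ph∉ , record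
    { proper = I ; head∈ = h∈ ; head-exit = Ph∉ ; parent∈ = parent∈ ; closed = closed }
    where
    parent∈ : ∀ x → toℕ x ∈[ a , b ⟩ → x ≢ h → P x ∈[ a , b ⟩
    parent∈ x x∈ x≢h with P x ∈[ a , b ⟩?
    ... | yes Px∈ = Px∈
    ... | no  Px∉ = contradiction (sym (siblings-in-interval Ph∉ h∈ x∈ (trans (entries h h∈ Ph∉) (sym (entries x x∈ Px∉))))) x≢h

  module _ {a b h} (B : Block a b h) where
    open Block B

    private
      H = toℕ h

    right-entry : ∀ x → toℕ x ∈[ suc H , b ⟩ → ¬ P x ∈[ suc H , b ⟩ → p x ≡ h
    right-entry x (H<x , x<b) Px∉ = toℕ-injective ([ absurd , id ]′ (m≤n⇒m<n∨m≡n Px≤H))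
      where
      Px∈B : P x ∈[ a , b ⟩
      Px∈B = parent∈ x (≤-trans (proj₁ head∈) (<⇒≤ H<x) , x<b) λ { refl → <-irrefl refl H<x }
      Px≤H : P x ≤ H
      Px≤H = ≮⇒≥ λ H<Px → Px∉ (H<Px , proj₂ Px∈B)
      absurd : P x < H → P x ≡ H
      absurd Px<H = let (Px<Ph , Ph≤x) = nested-right {x} {h} Px<H H<x
                    in ⊥-elim (head-exit (≤-trans (proj₁ Px∈B) (<⇒≤ Px<Ph) , ≤-<-trans Ph≤x x<b))

    right-closed : ∀ y → y ≢ fzero → ¬ toℕ y ∈[ suc H , b ⟩ → ¬ P y ∈[ suc H , b ⟩
    right-closed y y≢0 y∉ (H<Py , Py<b) = [ left-of-right , right-of-B ]′ (∉[]⇒ y∉)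
      where
      Py∈B : P y ∈[ a , b ⟩
      Py∈B = ≤-trans (proj₁ head∈) (<⇒≤ H<Py) , Py<b
      right-of-B : b ≤ toℕ y → ⊥
      right-of-B b≤y = closed y y≢0 (λ (_ , y<b) → <⇒≱ y<b b≤y) Py∈B
      left-of-head : toℕ y < H → Dec (a ≤ toℕ y) → ⊥
      left-of-head y<H (yes a≤y) = let (y≤Ph , Ph<Py) = nested-left {y} {h} y<H H<Py
                                   in  head-exit (≤-trans a≤y y≤Ph , <-trans Ph<Py Py<b)
      left-of-head y<H (no  a≰y) = closed y y≢0 (λ (a≤y , _) → a≰y a≤y) Py∈B
      left-of-right : toℕ y < suc H → ⊥
      left-of-right y<1+H = [ (λ y<H → left-of-head y<H (a ≤? toℕ y))
                            , (λ y≡H → head-exit (subst (λ z → P z ∈[ a , b ⟩) (toℕ-injective y≡H) Py∈B)) ]′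
                            (m≤n⇒m<n∨m≡n (s≤s⁻¹ y<1+H))

    left-entry : ∀ x → toℕ x ∈[ a , H ⟩ → ¬ P x ∈[ a , H ⟩ → p x ≡ h
    left-entry x (a≤x , x<H) Px∉ = toℕ-injective (sym ([ absurd , id ]′ (m≤n⇒m<n∨m≡n H≤Px)))
      where
      Px∈B : P x ∈[ a , b ⟩
      Px∈B = parent∈ x (a≤x , <-trans x<H (proj₂ head∈)) λ { refl → <-irrefl refl x<H }
      H≤Px : H ≤ P x
      H≤Px = ≮⇒≥ λ Px<H → Px∉ (proj₁ Px∈B , Px<H)
      absurd : H < P x → H ≡ P x
      absurd H<Px = let (x≤Ph , Ph<Px) = nested-left {x} {h} x<H H<Px
                    in ⊥-elim (head-exit (≤-trans a≤x x≤Ph , <-trans Ph<Px (proj₂ Px∈B)))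

    left-closed : ∀ y → y ≢ fzero → ¬ toℕ y ∈[ a , H ⟩ → ¬ P y ∈[ a , H ⟩
    left-closed y y≢0 y∉ (a≤Py , Py<H) = [ left-of-B , right-of-left ]′ (∉[]⇒ y∉)
      where
      Py∈B : P y ∈[ a , b ⟩
      Py∈B = a≤Py , <-trans Py<H (proj₂ head∈)
      left-of-B : toℕ y < a → ⊥
      left-of-B y<a = closed y y≢0 (λ (a≤y , _) → <⇒≱ y<a a≤y) Py∈B
      right-of-head : H < toℕ y → Dec (toℕ y < b) → ⊥
      right-of-head H<y (yes y<b) = let (Py<Ph , Ph≤y) = nested-right {y} {h} Py<H H<y
                                    in  head-exit (≤-trans a≤Py (<⇒≤ Py<Ph) , ≤-<-trans Ph≤y y<b)
      right-of-head H<y (no  y≮b) = closed y y≢0 (λ (_ , y<b) → y≮b y<b) Py∈B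
      right-of-left : H ≤ toℕ y → ⊥
      right-of-left H≤y = [ (λ H<y → right-of-head H<y (toℕ y <? b))
                          , (λ H≡y → head-exit (subst (λ z → P z ∈[ a , b ⟩) (toℕ-injective (sym H≡y)) Py∈B)) ]′
                          (m≤n⇒m<n∨m≡n H≤y)

  right-block : ∀ {a b h} → Block a b h → suc (toℕ h) < b → Σ V λ r → p r ≡ h × Block (suc (toℕ h)) b r
  right-block B H<b = block-below _ (s≤s z≤n , H<b , proj₂ (proj₂ (Block.proper B))) (right-entry B) (right-closed B)

  left-block : ∀ {a b h} → Block a b h → a < toℕ h → Σ V λ l → p l ≡ h × Block a (toℕ h) l
  left-block B a<H = block-below _ (proj₁ (Block.proper B) , a<H , ≤-trans (<⇒≤ (proj₂ (Block.head∈ B))) (proj₂ (proj₂ (Block.proper B))))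
                                   (left-entry B) (left-closed B)

  nonroot⇒positive : ∀ {y : V} → y ≢ fzero → 1 ≤ toℕ y
  nonroot⇒positive {fzero}  y≢0 = contradiction refl y≢0
  nonroot⇒positive {fsuc _} _   = s≤s z≤n

  top-block : 1 ≤ m → Σ V λ c → p c ≡ fzero × Block 1 (suc m) c
  top-block 1≤m = block-below fzero (≤-refl , s≤s 1≤m , ≤-refl) entries closed′
    where
    entries : ∀ x → toℕ x ∈[ 1 , suc m ⟩ → ¬ P x ∈[ 1 , suc m ⟩ → p x ≡ fzero
    entries x _ Px∉ = toℕ-injective (n<1⇒n≡0 (≰⇒> λ 1≤Px → Px∉ (1≤Px , toℕ<n (p x))))
    closed′ : ∀ y → y ≢ fzero → ¬ toℕ y ∈[ 1 , suc m ⟩ → ¬ P y ∈[ 1 , suc m ⟩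
    closed′ y y≢0 y∉ = contradiction (nonroot⇒positive y≢0 , toℕ<n y) y∉

  LeftChild RightChild : (ℕ → ℕ → V → Set) → ℕ → ℕ → V → Set
  LeftChild  Φ a b h = a < toℕ h → Σ V λ l → p l ≡ h × Φ a (toℕ h) l
  RightChild Φ a b h = suc (toℕ h) < b → Σ V λ r → p r ≡ h × Φ (suc (toℕ h)) b r

  BlockStep : (ℕ → ℕ → V → Set) → Set
  BlockStep Φ = ∀ {a b h} → Block a b h → LeftChild Φ a b h → RightChild Φ a b h → Φ a b h

  block-rec : (Φ : ℕ → ℕ → V → Set) → BlockStep Φ → ∀ {a b h} → Block a b h → Φ a b h
  block-rec Φ step {a} {b} = go b (m≤n+m b a)
    where
    go : ∀ k {a b h} → b ≤ a + k → Block a b h → Φ a b h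
    go zero {a} {b} {h} b≤a+0 B = ⊥-elim (<⇒≱ (≤-<-trans a≤H H<b) (subst (b ≤_) (+-identityʳ a) b≤a+0))
      where open Block B using (head∈)
            a≤H = proj₁ head∈
            H<b = proj₂ head∈
    go (suc k) {a} {b} {h} b≤a+1+k B = step B left right
      where
      open Block B using (head∈)
      b≤1+a+k : b ≤ suc (a + k)
      b≤1+a+k = subst (b ≤_) (+-suc a k) b≤a+1+k
      left : LeftChild Φ a b h
      left a<H = let (l , pl≡h , L) = left-block B a<H
                 in  l , pl≡h , go k (s≤s⁻¹ (≤-trans (proj₂ head∈) b≤1+a+k)) L
      right : RightChild Φ a b h
      right H<b = let (r , pr≡h , R) = right-block B H<b
                  in  r , pr≡h , go k (≤-trans b≤1+a+k (s≤s (+-monoˡ-≤ k (proj₁ head∈)))) R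

  head≢root : ∀ {a b h} → Block a b h → h ≢ fzero
  head≢root B refl = <⇒≱ (proj₁ (Block.proper B)) (proj₁ (Block.head∈ B))

  child-link : ∀ {l h} → p l ≡ h → h ≢ fzero → F h l
  child-link {l} refl h≢0 = parent-link λ { refl → h≢0 refl }

  head-ancestor : ∀ {a b h x} → Block a b h → toℕ x ∈[ a , b ⟩ → Ancestor F h x
  head-ancestor {x = x} B x∈ = block-rec Φ step B x x∈
    where
    Φ : ℕ → ℕ → V → Set
    Φ a b h = ∀ x → toℕ x ∈[ a , b ⟩ → Ancestor F h x
    step : BlockStep Φ
    step {h = h} B left right x (a≤x , x<b) with <-cmp (toℕ x) (toℕ h)
    ... | tri≈ _ x≡h _ rewrite toℕ-injective x≡h = 0 , []
    ... | tri< x<h _ _ with left (≤-<-trans a≤x x<h)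
    ...   | l , pl≡h , l↝ with l↝ x (a≤x , x<h)
    ...     | k , path = suc k , child-link pl≡h (head≢root B) ∷ path
    step {h = h} B left right x (a≤x , x<b) | tri> _ _ h<x with right (≤-<-trans h<x x<b)
    ...   | r , pr≡h , r↝ with r↝ x (h<x , x<b)
    ...     | k , path = suc k , child-link pr≡h (head≢root B) ∷ path

  record SplitBy (s t w : V) : Set where
    constructor splitBy
    field
      s≤w : toℕ s ≤ toℕ w
      w≤t : toℕ w ≤ toℕ t
      w↝s : Ancestor F w s
      w↝t : Ancestor F w t

  block-split : ∀ {a b h s t} → Block a b h → toℕ s ∈[ a , b ⟩ → toℕ t ∈[ a , b ⟩ → toℕ s ≤ toℕ t →
                Σ V (SplitBy s t)
  block-split {s = s} {t} B s∈ t∈ s≤t = block-rec Φ step B s t s∈ t∈ s≤t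
    where
    Φ : ℕ → ℕ → V → Set
    Φ a b h = ∀ s t → toℕ s ∈[ a , b ⟩ → toℕ t ∈[ a , b ⟩ → toℕ s ≤ toℕ t → Σ V (SplitBy s t)
    step : BlockStep Φ
    step {h = h} B left right s t (a≤s , s<b) (a≤t , t<b) s≤t with toℕ t <? toℕ h | toℕ h <? toℕ s
    ... | yes t<h | _ = proj₂ (proj₂ (left (≤-<-trans a≤s (≤-<-trans s≤t t<h)))) s t (a≤s , ≤-<-trans s≤t t<h) (a≤t , t<h) s≤t
    ... | no _ | yes h<s = proj₂ (proj₂ (right (≤-<-trans h<s s<b))) s t (h<s , s<b) (<-≤-trans h<s s≤t , t<b) s≤t
    ... | no t≮h | no h≮s = h , splitBy (≮⇒≥ h≮s) (≮⇒≥ t≮h) (head-ancestor B (a≤s , s<b)) (head-ancestor B (a≤t , t<b))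

  block-of-vertex : ∀ {a b h x} → Block a b h → toℕ x ∈[ a , b ⟩ → Σ ℕ λ a′ → Σ ℕ λ b′ → Block a′ b′ x
  block-of-vertex {x = x} B x∈ = block-rec Φ step B x x∈
    where
    Φ : ℕ → ℕ → V → Set
    Φ a b h = ∀ x → toℕ x ∈[ a , b ⟩ → Σ ℕ λ a′ → Σ ℕ λ b′ → Block a′ b′ x
    step : BlockStep Φ
    step {a} {b} {h} B left right x (a≤x , x<b) with <-cmp (toℕ x) (toℕ h)
    ... | tri≈ _ x≡h _ rewrite toℕ-injective x≡h = a , b , B
    ... | tri< x<h _ _ = proj₂ (proj₂ (left (≤-<-trans a≤x x<h))) x (a≤x , x<h)
    ... | tri> _ _ h<x = proj₂ (proj₂ (right (≤-<-trans h<x x<b))) x (h<x , x<b)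

  descendant-in-block : ∀ {a b h c x k} → Block a b h → Path F k c x → toℕ c ∈[ a , b ⟩ → toℕ x ∈[ a , b ⟩
  descendant-in-block B []           c∈ = c∈
  descendant-in-block {a} {b} B (_∷_ {b = d} Fcd path) c∈ with toℕ d ∈[ a , b ⟩?
  ... | yes d∈ = descendant-in-block B path d∈
  ... | no  d∉ = ⊥-elim (Block.closed B d (λ { refl → no-link-into-root Fcd }) d∉
                          (subst (λ z → toℕ z ∈[ a , b ⟩) (link⇒parent Fcd) c∈))

  unsnoc : ∀ {k a c} → Path F (suc k) a c → Σ V λ b → Path F k a b × F b c
  unsnoc (Fab ∷ [])           = _ , [] , Fab
  unsnoc (Fab ∷ path@(_ ∷ _)) with unsnoc path
  ... | b , init , Fbc = b , Fab ∷ init , Fbc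

  root-paths-same-length : ∀ {j k x} → Path F j fzero x → Path F k fzero x → j ≡ k
  root-paths-same-length {zero}  {zero}  _    _    = refl
  root-paths-same-length {zero}  {suc k} []   path = ⊥-elim (no-link-into-root (proj₂ (proj₂ (unsnoc path))))
  root-paths-same-length {suc j} {zero}  path []   = ⊥-elim (no-link-into-root (proj₂ (proj₂ (unsnoc path))))
  root-paths-same-length {suc j} {suc k} path path′ with unsnoc path | unsnoc path′
  ... | b , init , Fbx | b′ , init′ , Fb′x with link-tails-equal Fbx Fb′x
  ...   | refl = cong suc (root-paths-same-length init init′)

  module _ (1≤m : 1 ≤ m) where

    root-ancestor : ∀ x → Ancestor F fzero x
    root-ancestor fzero      = 0 , []
    root-ancestor x@(fsuc _) =
      let (c , pc≡0 , T) = top-block 1≤m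
          (k , c↝x)      = head-ancestor T (s≤s z≤n , toℕ<n x)
      in  suc k , subst (λ z → F z c) pc≡0 (parent-link (head≢root T)) ∷ c↝x

    split : ∀ {s t} → toℕ s ≤ toℕ t → Σ V (SplitBy s t)
    split {fzero}      {t} _   = fzero , splitBy z≤n z≤n (0 , []) (root-ancestor t)
    split {s@(fsuc _)} {t} s≤t =
      block-split (proj₂ (proj₂ (top-block 1≤m))) (s≤s z≤n , toℕ<n s) (≤-trans (s≤s z≤n) s≤t , toℕ<n t) s≤t

    ancestor-convex : ∀ {c s t y} → Ancestor F c s → Ancestor F c t → toℕ s ≤ toℕ y → toℕ y ≤ toℕ t → Ancestor F c y
    ancestor-convex {fzero}      {y = y} _ _ _ _ = root-ancestor y
    ancestor-convex {c@(fsuc _)} (_ , c↝s) (_ , c↝t) s≤y y≤t =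
      let (_ , _ , C) = block-of-vertex (proj₂ (proj₂ (top-block 1≤m))) (s≤s z≤n , toℕ<n c)
          s∈C = descendant-in-block C c↝s (Block.head∈ C)
          t∈C = descendant-in-block C c↝t (Block.head∈ C)
      in  head-ancestor C (∈[]-convex s∈C t∈C s≤y y≤t)

    depth : ∀ x → Σ ℕ (Dist F fzero x)
    depth x with root-ancestor x
    ... | d , path = d , path , λ j path′ → ≤-reflexive (root-paths-same-length path path′)

    depth-+ : ∀ {a b k da db} → Path F k a b → Dist F fzero a da → Dist F fzero b db → da + k ≡ db
    depth-+ path (root↝a , _) (root↝b , _) = root-paths-same-length (root↝a ++ₚ path) root↝b

    module _ {s t w} (w-splits : SplitBy s t w) (W : V → Set) (s∈W : W s) (t∈W : W t)
             (W⊆[s,t] : ∀ u → W u → toℕ s ≤ toℕ u × toℕ u ≤ toℕ t) where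

      open SplitBy w-splits

      common⇒ancestor-of-split : ∀ {a} → CommonAnc F W a → Ancestor F a w
      common⇒ancestor-of-split common = ancestor-convex (common s s∈W) (common t t∈W) s≤w w≤t

      split-common : CommonAnc F W w
      split-common u u∈W = ancestor-convex w↝s w↝t (proj₁ (W⊆[s,t] u u∈W)) (proj₂ (W⊆[s,t] u u∈W))

      isLCA⇔split : ∀ x → IsLCA F W x ⇔ x ≡ w
      isLCA⇔split x = mk⇔ isLCA⇒split split⇒isLCA
        where
        split⇒isLCA : x ≡ w → IsLCA F W x
        split⇒isLCA refl = split-common , λ a common da dw Da Dw →
          let (k , a↝w) = common⇒ancestor-of-split common
          in  subst (da ≤_) (depth-+ a↝w Da Dw) (m≤m+n da k)
        isLCA⇒split : IsLCA F W x → x ≡ w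
        isLCA⇒split (common , deepest) with common⇒ancestor-of-split common | depth x | depth w
        ... | zero  , []  | _ | _ = refl
        ... | suc k , x↝w | dx , Dx | dw , Dw =
          ⊥-elim (m+1+n≰m dx (subst (_≤ dx) (sym (depth-+ x↝w Dx Dw)) (deepest w split-common dw dx Dw Dx)))

lemma56 : (m : ℕ) → 2 ≤ m
    → (L : DLinks (suc m)) → (∀ u v → L u v → u ≢ v)
    → (F : DLinks (suc m)) → (∀ a b → F a b → Shadows L a b)
    → NonShortenable F
    → (U : Subset (suc m)) → (s t : Fin (suc m))
    → s ∈ U → (∀ u → u ∈ U → toℕ s ≤ toℕ u)
    → t ∈ U → (∀ u → u ∈ U → toℕ u ≤ toℕ t)
    → (Σ (Fin (suc m)) λ w → IsLCA F (_∈ U) w)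
      × (∀ w → IsLCA F (_∈ U) w ⇔ IsLCA F (λ x → (x ≡ s) ⊎ (x ≡ t)) w)
      × (∀ w → IsLCA F (_∈ U) w → Between s t w)
lemma56 m 2≤m _ _ F _ NS U s t s∈U s≤U t∈U U≤t =
  (w , from (lca-U w) refl) ,
  (λ x → ⇔-trans (lca-U x) (⇔-sym (lca-st x))) ,
  (λ x x-lca → subst (Between s t) (sym (to (lca-U x) x-lca)) (inj₁ (s≤w , w≤t)))
  where
  open NonShortenableSolution NS
  1≤m : 1 ≤ m
  1≤m = ≤-trans (s≤s z≤n) 2≤m
  s≤t : toℕ s ≤ toℕ t
  s≤t = s≤U t t∈U
  sw : Σ V (SplitBy s t)
  sw = split 1≤m s≤t
  w : V
  w = proj₁ sw
  open SplitBy (proj₂ sw)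
  endpoints : ∀ u → u ≡ s ⊎ u ≡ t → toℕ s ≤ toℕ u × toℕ u ≤ toℕ t
  endpoints _ (inj₁ refl) = ≤-refl , s≤t
  endpoints _ (inj₂ refl) = s≤t , ≤-refl
  lca-U : ∀ x → IsLCA F (_∈ U) x ⇔ x ≡ w
  lca-U = isLCA⇔split 1≤m (proj₂ sw) (_∈ U) s∈U t∈U λ u u∈U → s≤U u u∈U , U≤t u u∈U
  lca-st : ∀ x → IsLCA F (λ x → x ≡ s ⊎ x ≡ t) x ⇔ x ≡ w
  lca-st = isLCA⇔split 1≤m (proj₂ sw) (λ x → x ≡ s ⊎ x ≡ t) (inj₁ refl) (inj₂ refl) endpoints
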